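{- Let $V$ be a finite set equipped with two binary operations $+$ and $\times$, both associative and commutative, with elements $0,1\in V$ such that $a\times 1=a$, $a+0=a$, $a\times(b+c)=a\times b+a\times c$, $a+a=0$ and $a\times a=a$ for all $a,b,c\in V$. If $p_j$ and $p_k$ are (logical) primes of $V$, then $\sim p_j\times\sim p_k=\delta_{jk}\,\sim p_k$, where $\delta_{jk}=1$ if $p_j=p_k$ and $\delta_{jk}=0$ otherwise; in particular $\sim p_j\times \sim p_k=0$ for distinct primes $p_j\neq p_k$.
   Context: For $a\in V$ its negation is $\sim a:=a+1$. An element $p\in V$ is called a (logical) prime if for every $a\in V$, $p\times a=0$ implies $a=0$ or $a=\sim p$. Here $\delta_{jk}\sim p_k$ means $\sim p_k$ if $\delta_{jk}=1$ and $0$ if $\delta_{jk}=0$. -}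

module Defs where

open import Level using (Level; suc; _⊔_)
open import Data.Nat using (ℕ)
open import Data.Fin using (Fin)
open import Data.Product using (Σ)
open import Data.Sum using (_⊎_)
open import Relation.Binary.PropositionalEquality using (_≡_)
open import Relation.Nullary using (¬_)

-- A finite set V with operations + and × as in the paper (a Boolean ring).
-- Equality on V is propositional equality; finiteness: V is enumerated by
-- some surjection from Fin n.
record LogicAlgebra (ℓ : Level) : Set (suc ℓ) where
  infixl 6 _+_
  infixl 7 _×_
  field
    V     : Set ℓ
    _+_   : V → V → V
    _×_   : V → V → V
    𝟘 𝟙   : V
    finite    : Σ ℕ λ n → Σ (Fin n → V) λ f → (v : V) → Σ (Fin n) λ i → f i ≡ v
    +-assoc   : ∀ a b c → (a + b) + c ≡ a + (b + c)
    +-comm    : ∀ a b → a + b ≡ b + a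
    ×-assoc   : ∀ a b c → (a × b) × c ≡ a × (b × c)
    ×-comm    : ∀ a b → a × b ≡ b × a
    ×-identity : ∀ a → a × 𝟙 ≡ a
    +-identity : ∀ a → a + 𝟘 ≡ a
    distrib   : ∀ a b c → a × (b + c) ≡ a × b + a × c
    +-self    : ∀ a → a + a ≡ 𝟘
    ×-idem    : ∀ a → a × a ≡ a

  ∼_ : V → V
  ∼ a = a + 𝟙

  IsPrime : V → Set ℓ
  IsPrime p = ∀ a → p × a ≡ 𝟘 → (a ≡ 𝟘) ⊎ (a ≡ ∼ p)

  -- δ_{jk} ∼ p_k : ∼ p_k if p_j = p_k, and 0 otherwise
  -- (stated case-wise in the theorem).

module Submission where

-- For every element p of the algebra, p × ∼ p = p × p + p = p + p = 0.
-- Hence for any p, q the product ∼ p × ∼ q is annihilated by p and by q.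
-- If p is prime, annihilation by p forces ∼ p × ∼ q to be 0 or ∼ p; if q is
-- prime, it is likewise 0 or ∼ q.  So when it is non-zero it equals both ∼ p
-- and ∼ q, and since negation is an involution, p = q.  For equal primes the
-- product is ∼ p × ∼ p = ∼ p by idempotence.

open import Defs
open import Level using (Level)
open import Data.Product using (_,_) renaming (_×_ to _∧_)
open import Data.Sum using (inj₁; inj₂)
open import Relation.Binary.PropositionalEquality
  using (_≡_; refl; sym; trans; cong; cong₂; module ≡-Reasoning)
open import Relation.Nullary using (¬_; contradiction)

module Properties {ℓ : Level} (L : LogicAlgebra ℓ) where
  open LogicAlgebra L
  open ≡-Reasoning

  ×-zeroʳ : ∀ a → a × 𝟘 ≡ 𝟘
  ×-zeroʳ a = begin
    a × 𝟘             ≡⟨ cong (a ×_) (sym (+-self 𝟘)) ⟩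
    a × (𝟘 + 𝟘)       ≡⟨ distrib a 𝟘 𝟘 ⟩
    a × 𝟘 + a × 𝟘     ≡⟨ +-self (a × 𝟘) ⟩
    𝟘                 ∎

  ×-∼-zero : ∀ p → p × ∼ p ≡ 𝟘
  ×-∼-zero p = begin
    p × (p + 𝟙)       ≡⟨ distrib p p 𝟙 ⟩
    p × p + p × 𝟙     ≡⟨ cong₂ _+_ (×-idem p) (×-identity p) ⟩
    p + p             ≡⟨ +-self p ⟩
    𝟘                 ∎

  ∼-involutive : ∀ a → ∼ (∼ a) ≡ a
  ∼-involutive a = begin
    (a + 𝟙) + 𝟙       ≡⟨ +-assoc a 𝟙 𝟙 ⟩
    a + (𝟙 + 𝟙)       ≡⟨ cong (a +_) (+-self 𝟙) ⟩
    a + 𝟘             ≡⟨ +-identity a ⟩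
    a                 ∎

  ∼-injective : ∀ {a b} → ∼ a ≡ ∼ b → a ≡ b
  ∼-injective {a} {b} e = begin
    a                 ≡⟨ sym (∼-involutive a) ⟩
    ∼ (∼ a)           ≡⟨ cong ∼_ e ⟩
    ∼ (∼ b)           ≡⟨ ∼-involutive b ⟩
    b                 ∎

  annihilates-∼× : ∀ p b → p × (∼ p × b) ≡ 𝟘
  annihilates-∼× p b = begin
    p × (∼ p × b)     ≡⟨ sym (×-assoc p (∼ p) b) ⟩
    (p × ∼ p) × b     ≡⟨ cong (_× b) (×-∼-zero p) ⟩
    𝟘 × b             ≡⟨ ×-comm 𝟘 b ⟩
    b × 𝟘             ≡⟨ ×-zeroʳ b ⟩
    𝟘                 ∎

  annihilates-×∼ : ∀ a q → q × (a × ∼ q) ≡ 𝟘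
  annihilates-×∼ a q = trans (cong (q ×_) (×-comm a (∼ q))) (annihilates-∼× q a)

  ∼prime-orthogonal : ∀ {p q} → IsPrime p → IsPrime q → ¬ (p ≡ q) →
                      ∼ p × ∼ q ≡ 𝟘
  ∼prime-orthogonal {p} {q} prime-p prime-q p≢q
    with prime-p _ (annihilates-∼× p (∼ q)) | prime-q _ (annihilates-×∼ (∼ p) q)
  ... | inj₁ zero  | _          = zero
  ... | inj₂ _     | inj₁ zero  = zero
  ... | inj₂ is-∼p | inj₂ is-∼q = contradiction (∼-injective (trans (sym is-∼p) is-∼q)) p≢q

mainTheorem4 : ∀ {ℓ : Level} (L : LogicAlgebra ℓ) → let open LogicAlgebra L in
    ∀ (pj pk : V) → IsPrime pj → IsPrime pk →
    ((pj ≡ pk → (∼ pj) × (∼ pk) ≡ ∼ pk) ∧ (¬ (pj ≡ pk) → (∼ pj) × (∼ pk) ≡ 𝟘))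
mainTheorem4 L pj pk prime-j prime-k = equal , distinct
  where
  open LogicAlgebra L
  open Properties L

  equal : pj ≡ pk → ∼ pj × ∼ pk ≡ ∼ pk
  equal refl = ×-idem (∼ pj)

  distinct : ¬ (pj ≡ pk) → ∼ pj × ∼ pk ≡ 𝟘
  distinct = ∼prime-orthogonal prime-j prime-k
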